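{- Let $\mathcal{G}$ be a finite abstract simplicial complex. For $A\subseteq\mathcal{G}$ let $\omega(A)=\sum_{x,y\in A,\ x\cap y\in A}\omega(x)\omega(y)$ (Wu characteristic), where $\omega(x)=(-1)^{\dim x}$. Then $$\omega(\mathcal{G})=\sum_{x\in\mathcal{G}}\omega(x)\,\omega(U(x)),$$ where $U(x)=\{y\in\mathcal{G}: x\subseteq y\}$ is the star of $x$.
   Context: A finite abstract simplicial complex $\mathcal{G}$ is a finite set of non-empty finite sets such that every non-empty subset of an element of $\mathcal{G}$ is again in $\mathcal{G}$; $\dim x=|x|-1$. The condition $x\cap y\in A$ in particular requires $x\cap y\ne\emptyset$. -}

module Defs where

open import Data.Nat using (ℕ; _∸_)
open import Data.Integer using (ℤ; _+_; _*_; -_; _^_; 0ℤ; 1ℤ)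
open import Data.Bool using () renaming (_≟_ to _≟ᵇ_)
open import Data.Fin.Subset using (Subset; _⊆_; _∩_; Nonempty; ∣_∣)
open import Data.Fin.Subset.Properties using (_⊆?_)
open import Data.Vec.Properties using (≡-dec)
open import Data.List using (List; filter; map; concatMap; foldr)
open import Data.List.Relation.Unary.Unique.Propositional using (Unique)
open import Relation.Binary.Definitions using (DecidableEquality)
open import Relation.Nullary using (does; Dec)
open import Data.Bool using (if_then_else_)

Simplex : ℕ → Set
Simplex n = Subset n

_≟ₛ_ : ∀ {n} → DecidableEquality (Simplex n)
_≟ₛ_ = ≡-dec _≟ᵇ_

open import Data.List.Membership.Propositional public using (_∈_)
import Data.List.Membership.DecPropositional as DecMem

_∈?_ : ∀ {n} (x : Simplex n) (A : List (Simplex n)) → Dec (x ∈ A)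
_∈?_ {n} = DecMem._∈?_ (_≟ₛ_ {n})

record IsComplex {n : ℕ} (G : List (Simplex n)) : Set where
  field
    unique   : Unique G
    nonempty : ∀ {x} → x ∈ G → Nonempty x
    closed   : ∀ {x y} → x ∈ G → Nonempty y → y ⊆ x → y ∈ G

dim : ∀ {n} → Simplex n → ℕ
dim x = ∣ x ∣ ∸ 1

ω : ∀ {n} → Simplex n → ℤ
ω x = (- 1ℤ) ^ dim x

sumℤ : List ℤ → ℤ
sumℤ = foldr _+_ 0ℤ

wu : ∀ {n} → List (Simplex n) → ℤ
wu A = sumℤ (concatMap (λ x → map (λ y →
         if does ((x ∩ y) ∈? A) then ω x * ω y else 0ℤ) A) A)

U : ∀ {n} → List (Simplex n) → Simplex n → List (Simplex n)
U G x = filter (λ y → x ⊆? y) G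

module Submission where

-- For x, y ∈ G with w = x ∩ y ∈ G, the faces of G contained in w are exactly
-- the nonempty subsets of w, and Σ_{∅ ≠ z ⊆ w} ω(z) = 1 (the Euler
-- characteristic of a simplex). Inserting this factor 1 into every term of
-- ω(G) and exchanging the order of summation, the pairs counted together with a
-- face z are those with z ⊆ x ∩ y, i.e. exactly the pairs counted in ω(U(z)).
-- All sums are taken over the full powerset of the vertex set, where
-- reindexing and exchanging sums is unproblematic.

open import Defs
open import Data.Nat using (ℕ; zero; suc)
open import Data.Integer using (ℤ; _+_; _*_; -_; 0ℤ; 1ℤ; _^_)
open import Data.Integer.Properties
  using (+-assoc; +-identityˡ; +-identityʳ; +-inverseʳ; *-identityʳ; *-zeroˡ; *-zeroʳ;
         *-comm; *-distribˡ-+; -1*i≡-i; +-commutativeSemigroup)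
open import Algebra.Properties.CommutativeSemigroup +-commutativeSemigroup
  using (interchange)
open import Data.Bool using (Bool; true; false; not; _∧_; _∨_; if_then_else_)
open import Data.Vec using ([]; _∷_)
open import Data.Fin.Subset using (Subset; _⊆_; _∩_; Nonempty; ⊥; ∣_∣; inside; outside)
open import Data.Fin.Subset.Properties
  using (_⊆?_; ⊆-refl; ⊆-trans; p∩q⊆p; p∩q⊆q; x∈p∩q⁺; ∉⊥; Empty-unique; nonempty?)
open import Data.List using (List; []; _∷_; _++_; map; concatMap; filter)
open import Data.List.Properties using (map-cong)
open import Data.List.Relation.Unary.AllPairs using (_∷_)
open import Data.List.Relation.Unary.All.Properties using (All¬⇒¬Any)
open import Data.List.Relation.Unary.Unique.Propositional using (Unique)
open import Data.List.Relation.Unary.Unique.Propositional.Properties using (filter⁺)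
open import Data.List.Membership.Propositional.Properties using (∈-filter⁺; ∈-filter⁻)
open import Data.Product using (_,_; proj₁; proj₂)
open import Data.Empty using (⊥-elim)
open import Level using (Level)
open import Function using (_∘_)
open import Relation.Nullary using (does; yes; no; contradiction)
open import Relation.Nullary.Decidable using (decidable-stable; dec-true)
open import Relation.Unary using (Pred; Decidable)
open import Relation.Binary.PropositionalEquality
  using (_≡_; _≢_; refl; sym; trans; cong; cong₂; module ≡-Reasoning)

private variable
  ℓ : Level
  m n : ℕ

when : Bool → ℤ → ℤ
when b c = if b then c else 0ℤ

when-0 : ∀ b → when b 0ℤ ≡ 0ℤ
when-0 true  = refl
when-0 false = refl

when-*-when : ∀ a b (c t : ℤ) → when a (c * when b t) ≡ t * when a (when b c)
when-*-when true  true  c t = *-comm c t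
when-*-when true  false c t = trans (*-zeroʳ c) (sym (*-zeroʳ t))
when-*-when false _     c t = sym (*-zeroʳ t)

when-∧-reorder : ∀ d e a b c (t : ℤ) →
  when (d ∧ a) (when (e ∧ b) (when ((d ∧ e) ∧ c) t)) ≡
  when (d ∧ e) (when a (when b (when c t)))
when-∧-reorder false _     a b c t = refl
when-∧-reorder true  false a b c t = when-0 a
when-∧-reorder true  true  a b c t = refl

∑ : (Subset n → ℤ) → ℤ
∑ {zero}  f = f []
∑ {suc n} f = ∑ (λ z → f (outside ∷ z)) + ∑ (λ z → f (inside ∷ z))

∑-syntax : (Subset n → ℤ) → ℤ
∑-syntax = ∑

syntax ∑-syntax (λ z → e) = ∑[ z ] e

∑-cong : {f g : Subset n → ℤ} → (∀ z → f z ≡ g z) → ∑ f ≡ ∑ g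
∑-cong {zero}  f≗g = f≗g []
∑-cong {suc n} f≗g =
  cong₂ _+_ (∑-cong (f≗g ∘ (outside ∷_))) (∑-cong (f≗g ∘ (inside ∷_)))

∑-0 : ∀ {n} → ∑ {n} (λ _ → 0ℤ) ≡ 0ℤ
∑-0 {zero}  = refl
∑-0 {suc n} = cong₂ _+_ (∑-0 {n}) (∑-0 {n})

∑-distrib-+ : (f g : Subset n → ℤ) → ∑[ z ] (f z + g z) ≡ ∑ f + ∑ g
∑-distrib-+ {zero}  f g = refl
∑-distrib-+ {suc n} f g = trans
  (cong₂ _+_ (∑-distrib-+ (f ∘ (outside ∷_)) (g ∘ (outside ∷_)))
             (∑-distrib-+ (f ∘ (inside ∷_)) (g ∘ (inside ∷_))))
  (interchange (∑ (f ∘ (outside ∷_))) (∑ (g ∘ (outside ∷_)))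
               (∑ (f ∘ (inside ∷_))) (∑ (g ∘ (inside ∷_))))

*-distribˡ-∑ : (c : ℤ) (f : Subset n → ℤ) → c * ∑ f ≡ ∑[ z ] (c * f z)
*-distribˡ-∑ {zero}  c f = refl
*-distribˡ-∑ {suc n} c f = trans
  (*-distribˡ-+ c (∑ (f ∘ (outside ∷_))) (∑ (f ∘ (inside ∷_))))
  (cong₂ _+_ (*-distribˡ-∑ c (f ∘ (outside ∷_))) (*-distribˡ-∑ c (f ∘ (inside ∷_))))

when-∑ : ∀ b (f : Subset n → ℤ) → when b (∑ f) ≡ ∑[ z ] when b (f z)
when-∑ true  f = refl
when-∑ {n} false f = sym (∑-0 {n})

when-*-∑ : ∀ b c (f : Subset n → ℤ) → when b (c * ∑ f) ≡ ∑[ z ] when b (c * f z)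
when-*-∑ true  c f = *-distribˡ-∑ c f
when-*-∑ {n} false c f = sym (∑-0 {n})

∑-when-≟ : (a : Subset n) (c : ℤ) → ∑[ z ] when (does (z ≟ₛ a)) c ≡ c
∑-when-≟ [] c = refl
∑-when-≟ {suc n} (outside ∷ a) c =
  trans (cong₂ _+_ (∑-when-≟ a c) (∑-0 {n})) (+-identityʳ c)
∑-when-≟ {suc n} (inside ∷ a) c =
  trans (cong₂ _+_ (∑-0 {n}) (∑-when-≟ a c)) (+-identityˡ c)

∑-comm : (f : Subset m → Subset n → ℤ) → ∑[ x ] ∑[ y ] f x y ≡ ∑[ y ] ∑[ x ] f x y
∑-comm {zero}  f = refl
∑-comm {suc m} f = trans
  (cong₂ _+_ (∑-comm (f ∘ (outside ∷_))) (∑-comm (f ∘ (inside ∷_))))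
  (sym (∑-distrib-+ (λ y → ∑[ x ] f (outside ∷ x) y) (λ y → ∑[ x ] f (inside ∷ x) y)))

sumℤ-++ : (xs ys : List ℤ) → sumℤ (xs ++ ys) ≡ sumℤ xs + sumℤ ys
sumℤ-++ []       ys = sym (+-identityˡ _)
sumℤ-++ (x ∷ xs) ys = trans (cong (x +_) (sumℤ-++ xs ys)) (sym (+-assoc x _ _))

sumℤ-concatMap : ∀ {A : Set} (f : A → List ℤ) (xs : List A) →
  sumℤ (concatMap f xs) ≡ sumℤ (map (sumℤ ∘ f) xs)
sumℤ-concatMap f []       = refl
sumℤ-concatMap f (x ∷ xs) =
  trans (sumℤ-++ (f x) (concatMap f xs)) (cong (sumℤ (f x) +_) (sumℤ-concatMap f xs))

sumℤ-map-as-∑ : {L : List (Simplex n)} (g : Simplex n → ℤ) → Unique L →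
  sumℤ (map g L) ≡ ∑[ x ] when (does (x ∈? L)) (g x)
sumℤ-map-as-∑ {n} {[]}    g _        = sym (∑-0 {n})
sumℤ-map-as-∑ {n} {a ∷ L} g (a∉L ∷ u) = sym (begin
  ∑[ x ] when (does (x ≟ₛ a) ∨ does (x ∈? L)) (g x)
    ≡⟨ ∑-cong split ⟩
  ∑[ x ] (when (does (x ≟ₛ a)) (g a) + when (does (x ∈? L)) (g x))
    ≡⟨ ∑-distrib-+ {n} _ _ ⟩
  ∑[ x ] when (does (x ≟ₛ a)) (g a) + ∑[ x ] when (does (x ∈? L)) (g x)
    ≡⟨ cong₂ _+_ (∑-when-≟ a (g a)) (sym (sumℤ-map-as-∑ g u)) ⟩
  g a + sumℤ (map g L) ∎)
  where
  open ≡-Reasoning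
  split : ∀ x → when (does (x ≟ₛ a) ∨ does (x ∈? L)) (g x) ≡
                when (does (x ≟ₛ a)) (g a) + when (does (x ∈? L)) (g x)
  split x with x ≟ₛ a | x ∈? L
  ... | yes refl | yes a∈L = contradiction a∈L (All¬⇒¬Any a∉L)
  ... | yes refl | no _    = sym (+-identityʳ (g a))
  ... | no _     | _       = sym (+-identityˡ _)

wuTerm : List (Simplex n) → Simplex n → Simplex n → ℤ
wuTerm A x y = when (does (x ∈? A)) (when (does (y ∈? A)) (when (does ((x ∩ y) ∈? A)) (ω x * ω y)))

wu-as-∑ : {A : List (Simplex n)} → Unique A → wu A ≡ ∑[ x ] ∑[ y ] wuTerm A x y
wu-as-∑ {n} {A} u = begin
  wu A
    ≡⟨ sumℤ-concatMap (λ x → map (T x) A) A ⟩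
  sumℤ (map (λ x → sumℤ (map (T x) A)) A)
    ≡⟨ cong sumℤ (map-cong (λ x → sumℤ-map-as-∑ (T x) u) A) ⟩
  sumℤ (map (λ x → ∑[ y ] when (does (y ∈? A)) (T x y)) A)
    ≡⟨ sumℤ-map-as-∑ _ u ⟩
  ∑[ x ] when (does (x ∈? A)) (∑[ y ] when (does (y ∈? A)) (T x y))
    ≡⟨ ∑-cong (λ x → when-∑ (does (x ∈? A)) (λ y → when (does (y ∈? A)) (T x y))) ⟩
  ∑[ x ] ∑[ y ] wuTerm A x y ∎
  where
  open ≡-Reasoning
  T : Simplex n → Simplex n → ℤ
  T x y = when (does ((x ∩ y) ∈? A)) (ω x * ω y)

wuTerm-*-weight : {A : List (Simplex n)} (x y : Simplex n) (s : ℤ) →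
  ((x ∩ y) ∈ A → s ≡ 1ℤ) → wuTerm A x y * s ≡ wuTerm A x y
wuTerm-*-weight {A = A} x y s s≡1 with (x ∩ y) ∈? A
... | yes x∩y∈A rewrite s≡1 x∩y∈A = *-identityʳ _
... | no _ rewrite when-0 (does (y ∈? A)) | when-0 (does (x ∈? A)) = *-zeroˡ s

does-∈-filter : {P : Pred (Simplex n) ℓ} (P? : Decidable P) (x : Simplex n)
  (L : List (Simplex n)) →
  does (x ∈? filter P? L) ≡ does (P? x) ∧ does (x ∈? L)
does-∈-filter P? x L with x ∈? filter P? L | P? x | x ∈? L
... | yes x∈F | no ¬Px | _       = contradiction (proj₂ (∈-filter⁻ P? {xs = L} x∈F)) ¬Px
... | yes x∈F | yes _  | no x∉L  = contradiction (proj₁ (∈-filter⁻ P? {xs = L} x∈F)) x∉L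
... | yes _   | yes _  | yes _   = refl
... | no x∉F  | yes Px | yes x∈L = contradiction (∈-filter⁺ P? x∈L Px) x∉F
... | no _    | yes _  | no _    = refl
... | no _    | no _   | _       = refl

does-⊆-∩ : (z x y : Simplex n) → does (z ⊆? x ∩ y) ≡ does (z ⊆? x) ∧ does (z ⊆? y)
does-⊆-∩ z x y with z ⊆? x | z ⊆? y | z ⊆? x ∩ y
... | yes z⊆x | yes z⊆y | no z⊈x∩y = ⊥-elim (z⊈x∩y (λ i∈z → x∈p∩q⁺ (z⊆x i∈z , z⊆y i∈z)))
... | no z⊈x  | _       | yes z⊆x∩y = ⊥-elim (z⊈x (⊆-trans z⊆x∩y (p∩q⊆p x y)))
... | yes _   | no z⊈y  | yes z⊆x∩y = ⊥-elim (z⊈y (⊆-trans z⊆x∩y (p∩q⊆q x y)))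
... | yes _   | yes _   | yes _ = refl
... | yes _   | no _    | no _  = refl
... | no _    | _       | no _  = refl

wuTerm-star : (G : List (Simplex n)) (z x y : Simplex n) →
  wuTerm (U G z) x y ≡ when (does (z ⊆? x ∩ y)) (wuTerm G x y)
wuTerm-star G z x y = begin
  W (does (x ∈? U G z)) (does (y ∈? U G z)) (does ((x ∩ y) ∈? U G z))
    ≡⟨ cong₂ (λ a b → W a b (does ((x ∩ y) ∈? U G z))) (∈-star x) (∈-star y) ⟩
  W (zx ∧ bx) (zy ∧ by) (does ((x ∩ y) ∈? U G z))
    ≡⟨ cong (W (zx ∧ bx) (zy ∧ by)) (trans (∈-star (x ∩ y)) (cong (_∧ bw) (does-⊆-∩ z x y))) ⟩
  W (zx ∧ bx) (zy ∧ by) ((zx ∧ zy) ∧ bw)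
    ≡⟨ when-∧-reorder zx zy bx by bw (ω x * ω y) ⟩
  when (zx ∧ zy) (wuTerm G x y)
    ≡⟨ cong (λ b → when b (wuTerm G x y)) (sym (does-⊆-∩ z x y)) ⟩
  when (does (z ⊆? x ∩ y)) (wuTerm G x y) ∎
  where
  open ≡-Reasoning
  zx zy bx by bw : Bool
  zx = does (z ⊆? x)
  zy = does (z ⊆? y)
  bx = does (x ∈? G)
  by = does (y ∈? G)
  bw = does ((x ∩ y) ∈? G)
  W : Bool → Bool → Bool → ℤ
  W a b c = when a (when b (when c (ω x * ω y)))
  ∈-star : ∀ v → does (v ∈? U G z) ≡ does (z ⊆? v) ∧ does (v ∈? G)
  ∈-star v = does-∈-filter (z ⊆?_) v G

isNonempty : Subset n → Bool
isNonempty z = not (does (z ≟ₛ ⊥))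

≢⊥⇒Nonempty : ∀ {p : Subset n} → p ≢ ⊥ → Nonempty p
≢⊥⇒Nonempty {p = p} p≢⊥ = decidable-stable (nonempty? p) (p≢⊥ ∘ Empty-unique)

-- Stated with (-1)^|z|, not ω z: the truncated dim ∅ = 0 ∸ 1 = 0 gives ω ∅ = 1.
∑-sign-subsets : (w : Subset n) →
  ∑[ z ] when (does (z ⊆? w)) ((- 1ℤ) ^ ∣ z ∣) ≡ when (does (w ≟ₛ ⊥)) 1ℤ
∑-sign-subsets []                     = refl
∑-sign-subsets {suc n} (outside ∷ w) =
  trans (cong₂ _+_ (∑-sign-subsets w) (∑-0 {n})) (+-identityʳ _)
∑-sign-subsets {suc n} (inside ∷ w) = begin
  s + ∑[ z ] when (does (z ⊆? w)) (- 1ℤ * (- 1ℤ) ^ ∣ z ∣)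
    ≡⟨ cong (s +_) (∑-cong flip) ⟩
  s + ∑[ z ] (- 1ℤ * f z)
    ≡⟨ cong (s +_) (sym (*-distribˡ-∑ (- 1ℤ) f)) ⟩
  s + - 1ℤ * s
    ≡⟨ cong (s +_) (-1*i≡-i s) ⟩
  s + - s
    ≡⟨ +-inverseʳ s ⟩
  0ℤ ∎
  where
  open ≡-Reasoning
  f : Subset n → ℤ
  f z = when (does (z ⊆? w)) ((- 1ℤ) ^ ∣ z ∣)
  s : ℤ
  s = ∑ f
  flip : ∀ z → when (does (z ⊆? w)) (- 1ℤ * (- 1ℤ) ^ ∣ z ∣) ≡ - 1ℤ * f z
  flip z with does (z ⊆? w)
  ... | true  = refl
  ... | false = refl

∑-ω-nonempty-subsets : (w : Subset n) →
  ∑[ z ] when (does (z ⊆? w)) (when (isNonempty z) (ω z)) ≡ when (isNonempty w) 1ℤ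
∑-ω-nonempty-subsets []                     = refl
∑-ω-nonempty-subsets {suc n} (outside ∷ w) =
  trans (cong₂ _+_ (∑-ω-nonempty-subsets w) (∑-0 {n})) (+-identityʳ _)
∑-ω-nonempty-subsets {suc n} (inside ∷ w)
  rewrite ∑-ω-nonempty-subsets w | ∑-sign-subsets w with does (w ≟ₛ ⊥)
... | true  = refl
... | false = refl

module _ {G : List (Simplex n)} (isC : IsComplex G) where
  open IsComplex isC

  does-∈-faces : ∀ {w z} → w ∈ G → z ⊆ w → does (z ∈? G) ≡ isNonempty z
  does-∈-faces {w} {z} w∈G z⊆w with z ∈? G | z ≟ₛ ⊥
  ... | yes z∈G | yes refl = contradiction (proj₂ (nonempty z∈G)) ∉⊥
  ... | yes _   | no _     = refl
  ... | no _    | yes _    = refl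
  ... | no z∉G  | no z≢⊥   = contradiction (closed w∈G (≢⊥⇒Nonempty z≢⊥) z⊆w) z∉G

  ∑-ω-faces : ∀ {w} → w ∈ G → ∑[ z ] when (does (z ∈? G)) (when (does (z ⊆? w)) (ω z)) ≡ 1ℤ
  ∑-ω-faces {w} w∈G = begin
    ∑[ z ] when (does (z ∈? G)) (when (does (z ⊆? w)) (ω z))
      ≡⟨ ∑-cong faces-are-nonempty-subsets ⟩
    ∑[ z ] when (does (z ⊆? w)) (when (isNonempty z) (ω z))
      ≡⟨ ∑-ω-nonempty-subsets w ⟩
    when (isNonempty w) 1ℤ
      ≡⟨ cong (λ b → when b 1ℤ) (sym (does-∈-faces w∈G ⊆-refl)) ⟩
    when (does (w ∈? G)) 1ℤ
      ≡⟨ cong (λ b → when b 1ℤ) (dec-true (w ∈? G) w∈G) ⟩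
    1ℤ ∎
    where
    open ≡-Reasoning
    faces-are-nonempty-subsets : ∀ z → when (does (z ∈? G)) (when (does (z ⊆? w)) (ω z)) ≡
                                       when (does (z ⊆? w)) (when (isNonempty z) (ω z))
    faces-are-nonempty-subsets z with z ⊆? w
    ... | yes z⊆w = cong (λ b → when b (ω z)) (does-∈-faces w∈G z⊆w)
    ... | no _    = when-0 (does (z ∈? G))

  wuTerm-as-∑-star : ∀ x y → ∑[ z ] when (does (z ∈? G)) (ω z * wuTerm (U G z) x y) ≡ wuTerm G x y
  wuTerm-as-∑-star x y = begin
    ∑[ z ] when (does (z ∈? G)) (ω z * wuTerm (U G z) x y)
      ≡⟨ ∑-cong (λ z → cong (λ t → when (does (z ∈? G)) (ω z * t)) (wuTerm-star G z x y)) ⟩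
    ∑[ z ] when (does (z ∈? G)) (ω z * when (does (z ⊆? x ∩ y)) t)
      ≡⟨ ∑-cong (λ z → when-*-when (does (z ∈? G)) (does (z ⊆? x ∩ y)) (ω z) t) ⟩
    ∑[ z ] (t * faces z)
      ≡⟨ sym (*-distribˡ-∑ t faces) ⟩
    t * ∑ faces
      ≡⟨ wuTerm-*-weight x y (∑ faces) ∑-ω-faces ⟩
    t ∎
    where
    open ≡-Reasoning
    t : ℤ
    t = wuTerm G x y
    faces : Simplex n → ℤ
    faces z = when (does (z ∈? G)) (when (does (z ⊆? x ∩ y)) (ω z))

  weighted-wu-star : ∀ z → when (does (z ∈? G)) (ω z * wu (U G z)) ≡
                           ∑[ x ] ∑[ y ] when (does (z ∈? G)) (ω z * wuTerm (U G z) x y)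
  weighted-wu-star z = begin
    when (does (z ∈? G)) (ω z * wu (U G z))
      ≡⟨ cong (λ s → when (does (z ∈? G)) (ω z * s)) (wu-as-∑ (filter⁺ (z ⊆?_) unique)) ⟩
    when (does (z ∈? G)) (ω z * ∑[ x ] ∑[ y ] wuTerm (U G z) x y)
      ≡⟨ when-*-∑ (does (z ∈? G)) (ω z) (λ x → ∑[ y ] wuTerm (U G z) x y) ⟩
    ∑[ x ] when (does (z ∈? G)) (ω z * ∑[ y ] wuTerm (U G z) x y)
      ≡⟨ ∑-cong (λ x → when-*-∑ (does (z ∈? G)) (ω z) (wuTerm (U G z) x)) ⟩
    ∑[ x ] ∑[ y ] when (does (z ∈? G)) (ω z * wuTerm (U G z) x y) ∎
    where open ≡-Reasoning

mainTheorem10 : (n : ℕ) (G : List (Simplex n)) → IsComplex G →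
    wu G ≡ sumℤ (map (λ x → ω x * wu (U G x)) G)
mainTheorem10 n G isC = begin
  wu G
    ≡⟨ wu-as-∑ unique ⟩
  ∑[ x ] ∑[ y ] wuTerm G x y
    ≡⟨ ∑-cong (λ x → ∑-cong (λ y → sym (wuTerm-as-∑-star isC x y))) ⟩
  ∑[ x ] ∑[ y ] ∑[ z ] F z x y
    ≡⟨ ∑-cong (λ x → ∑-comm (λ y z → F z x y)) ⟩
  ∑[ x ] ∑[ z ] ∑[ y ] F z x y
    ≡⟨ ∑-comm (λ x z → ∑[ y ] F z x y) ⟩
  ∑[ z ] ∑[ x ] ∑[ y ] F z x y
    ≡⟨ ∑-cong (λ z → sym (weighted-wu-star isC z)) ⟩
  ∑[ z ] when (does (z ∈? G)) (ω z * wu (U G z))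
    ≡⟨ sym (sumℤ-map-as-∑ (λ z → ω z * wu (U G z)) unique) ⟩
  sumℤ (map (λ z → ω z * wu (U G z)) G) ∎
  where
  open ≡-Reasoning
  open IsComplex isC
  F : Simplex n → Simplex n → Simplex n → ℤ
  F z x y = when (does (z ∈? G)) (ω z * wuTerm (U G z) x y)
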